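{- Let $F=\alpha_1.F_1|\cdots|\alpha_k.F_k$ be a finite process, $F'$ a finite process, $\alpha$ an action and $Q$ a process. If $!F\sim \alpha.F'|Q$, then $!F\sim\ !F|\alpha.F'$.
   Context: Fix a countable set of actions. Finite processes: $F ::= 0 \mid \alpha.F \mid F|F$. Processes: $P ::= F \mid\ !\alpha.F \mid P|P$. For $F=\alpha_1.F_1|\cdots|\alpha_k.F_k$, $!F$ denotes $!\alpha_1.F_1|\cdots|\,!\alpha_k.F_k$. Transitions: $\alpha.F\xrightarrow{\alpha}F$; $!\alpha.F\xrightarrow{\alpha}\ !\alpha.F|F$; if $P_1\xrightarrow{\alpha}P_1'$ then $P_1|P_2\xrightarrow{\alpha}P_1'|P_2$ and $P_2|P_1\xrightarrow{\alpha}P_2|P_1'$. $\sim$ is strong bisimilarity for this transition system. -}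

module Defs where

open import Level using (suc; zero)
open import Data.List using (List; []; _∷_)
open import Data.Product using (Σ; _×_; _,_)

data FProc (Act : Set) : Set where
  nil  : FProc Act
  pre  : Act → FProc Act → FProc Act
  fpar : FProc Act → FProc Act → FProc Act

data Proc (Act : Set) : Set where
  fin  : FProc Act → Proc Act
  bang : Act → FProc Act → Proc Act
  par  : Proc Act → Proc Act → Proc Act

data _─F[_]→_ {Act : Set} : FProc Act → Act → FProc Act → Set where
  f-pre  : ∀ {a F} → pre a F ─F[ a ]→ F
  f-parL : ∀ {a F₁ F₁' F₂} → F₁ ─F[ a ]→ F₁' → fpar F₁ F₂ ─F[ a ]→ fpar F₁' F₂
  f-parR : ∀ {a F₁ F₂ F₂'} → F₂ ─F[ a ]→ F₂' → fpar F₁ F₂ ─F[ a ]→ fpar F₁ F₂'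

data _─[_]→_ {Act : Set} : Proc Act → Act → Proc Act → Set where
  p-fin  : ∀ {a F F'} → F ─F[ a ]→ F' → fin F ─[ a ]→ fin F'
  p-bang : ∀ {a F} → bang a F ─[ a ]→ par (bang a F) (fin F)
  p-parL : ∀ {a P₁ P₁' P₂} → P₁ ─[ a ]→ P₁' → par P₁ P₂ ─[ a ]→ par P₁' P₂
  p-parR : ∀ {a P₁ P₂ P₂'} → P₂ ─[ a ]→ P₂' → par P₁ P₂ ─[ a ]→ par P₁ P₂'

IsBisimulation : {Act : Set} → (Proc Act → Proc Act → Set) → Set
IsBisimulation {Act} R =
  ∀ {P Q} → R P Q →
    (∀ {a P'} → P ─[ a ]→ P' → Σ (Proc Act) λ Q' → (Q ─[ a ]→ Q') × R P' Q')
    × (∀ {a Q'} → Q ─[ a ]→ Q' → Σ (Proc Act) λ P' → (P ─[ a ]→ P') × R P' Q')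

_∼_ : {Act : Set} → Proc Act → Proc Act → Set₁
_∼_ {Act} P Q = Σ (Proc Act → Proc Act → Set) λ R → IsBisimulation R × R P Q

-- For F = α₁.F₁ | ⋯ | αₖ.Fₖ, given as the list [(α₁,F₁),…,(αₖ,Fₖ)]:
-- the finite process F itself, and  !F = !α₁.F₁ | ⋯ | !αₖ.Fₖ
parPrefixes : {Act : Set} → List (Act × FProc Act) → FProc Act
parPrefixes []              = nil
parPrefixes ((a , F) ∷ [])  = pre a F
parPrefixes ((a , F) ∷ xs)  = fpar (pre a F) (parPrefixes xs)

bangAll : {Act : Set} → List (Act × FProc Act) → Proc Act
bangAll []              = fin nil
bangAll ((a , F) ∷ [])  = bang a F
bangAll ((a , F) ∷ xs)  = par (bang a F) (bangAll xs)

-- Every derivative of !F is structurally congruent to !F | X, so !F ∼ !F | !F.  Take the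
-- relation generated by a bisimulation relating !F with α.F' | Q, structural congruence,
-- !F ≈ !F | !F, and the rule: if !F ≈ A | C then Z | !F | A ≈ Z | !F.  It is a bisimulation:
-- a move of A inside Z | !F | A is answered by the matching move of A | C, simulated by !F,
-- and the extra copy of C this creates is absorbed again by the rule.  The rule with
-- Z = 0, A = α.F', C = Q gives !F ∼ !F | α.F'.
module Submission where

open import Defs
open import Level using (0ℓ)
open import Data.Nat using (ℕ)
open import Data.List using (List; []; _∷_)
open import Data.Product using (_×_; Σ; _,_; proj₂)
open import Function using (flip)
open import Function.Definitions using (Injective)
open import Relation.Binary.Core using (Rel)
open import Relation.Binary.Bundles using (Setoid)
open import Relation.Binary.PropositionalEquality using (_≡_)
import Relation.Binary.Reasoning.Setoid as SetoidReasoning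

private
  variable
    Act : Set
    a : Act
    A C P Q S W Z P₁ P₂ Q₁ Q₂ : Proc Act

Progress : Rel (Proc Act) 0ℓ → Rel (Proc Act) 0ℓ
Progress {Act} T P Q =
    (∀ {a P'} → P ─[ a ]→ P' → Σ (Proc Act) λ Q' → (Q ─[ a ]→ Q') × T P' Q')
  × (∀ {a Q'} → Q ─[ a ]→ Q' → Σ (Proc Act) λ P' → (P ─[ a ]→ P') × T P' Q')

module _ {T : Rel (Proc Act) 0ℓ} where

  progress-map : {U : Rel (Proc Act) 0ℓ} → (∀ {P Q} → T P Q → U P Q) →
                 Progress T P Q → Progress U P Q
  progress-map f (fwd , bwd) =
      (λ t → let (Q' , t' , r) = fwd t in Q' , t' , f r)
    , (λ t → let (P' , t' , r) = bwd t in P' , t' , f r)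

  progress-flip : Progress T P Q → Progress (flip T) Q P
  progress-flip (fwd , bwd) = bwd , fwd

  progress-trans : (∀ {P Q S} → T P Q → T Q S → T P S) →
                   Progress T P Q → Progress T Q S → Progress T P S
  progress-trans _∙_ (fwd₁ , bwd₁) (fwd₂ , bwd₂) =
      (λ t → let (Q' , t₁ , r₁) = fwd₁ t ; (S' , t₂ , r₂) = fwd₂ t₁ in S' , t₂ , r₁ ∙ r₂)
    , (λ t → let (Q' , t₁ , r₁) = bwd₂ t ; (P' , t₂ , r₂) = bwd₁ t₁ in P' , t₂ , r₂ ∙ r₁)

  progress-par : (∀ {P₁ P₂ Q₁ Q₂} → T P₁ Q₁ → T P₂ Q₂ → T (par P₁ P₂) (par Q₁ Q₂)) →
                 T P₁ Q₁ → T P₂ Q₂ → Progress T P₁ Q₁ → Progress T P₂ Q₂ →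
                 Progress T (par P₁ P₂) (par Q₁ Q₂)
  progress-par cong r₁ r₂ (fwd₁ , bwd₁) (fwd₂ , bwd₂) =
      (λ { (p-parL t) → let (_ , t' , r) = fwd₁ t in _ , p-parL t' , cong r r₂
         ; (p-parR t) → let (_ , t' , r) = fwd₂ t in _ , p-parR t' , cong r₁ r })
    , (λ { (p-parL t) → let (_ , t' , r) = bwd₁ t in _ , p-parL t' , cong r r₂
         ; (p-parR t) → let (_ , t' , r) = bwd₂ t in _ , p-parR t' , cong r₁ r })

infix 4 _≡ₛ_

data _≡ₛ_ {Act : Set} : Rel (Proc Act) 0ℓ where
  refl          : P ≡ₛ P
  sym           : P ≡ₛ Q → Q ≡ₛ P
  trans         : P ≡ₛ Q → Q ≡ₛ S → P ≡ₛ S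
  par-cong      : P₁ ≡ₛ Q₁ → P₂ ≡ₛ Q₂ → par P₁ P₂ ≡ₛ par Q₁ Q₂
  par-comm      : par P Q ≡ₛ par Q P
  par-assoc     : par (par P Q) S ≡ₛ par P (par Q S)
  par-identityˡ : par (fin nil) P ≡ₛ P

par-swapʳ : par (par P Q) S ≡ₛ par (par P S) Q
par-swapʳ = trans par-assoc (trans (par-cong refl par-comm) (sym par-assoc))

par-swapˡ : par P (par Q S) ≡ₛ par Q (par P S)
par-swapˡ = trans (sym par-assoc) (trans (par-cong par-comm refl) par-assoc)

≡ₛ-isBisimulation : IsBisimulation (_≡ₛ_ {Act})
≡ₛ-isBisimulation refl = (λ t → _ , t , refl) , (λ t → _ , t , refl)
≡ₛ-isBisimulation (sym e) = progress-map sym (progress-flip (≡ₛ-isBisimulation e))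
≡ₛ-isBisimulation (trans e f) =
  progress-trans trans (≡ₛ-isBisimulation e) (≡ₛ-isBisimulation f)
≡ₛ-isBisimulation (par-cong e f) =
  progress-par par-cong e f (≡ₛ-isBisimulation e) (≡ₛ-isBisimulation f)
≡ₛ-isBisimulation par-comm =
    (λ { (p-parL t) → _ , p-parR t , par-comm ; (p-parR t) → _ , p-parL t , par-comm })
  , (λ { (p-parL t) → _ , p-parR t , par-comm ; (p-parR t) → _ , p-parL t , par-comm })
≡ₛ-isBisimulation par-assoc =
    (λ { (p-parL (p-parL t)) → _ , p-parL t , par-assoc
       ; (p-parL (p-parR t)) → _ , p-parR (p-parL t) , par-assoc
       ; (p-parR t)          → _ , p-parR (p-parR t) , par-assoc })
  , (λ { (p-parL t)          → _ , p-parL (p-parL t) , par-assoc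
       ; (p-parR (p-parL t)) → _ , p-parL (p-parR t) , par-assoc
       ; (p-parR (p-parR t)) → _ , p-parR t , par-assoc })
≡ₛ-isBisimulation par-identityˡ =
    (λ { (p-parL (p-fin ())) ; (p-parR t) → _ , t , par-identityˡ })
  , (λ t → _ , p-parR t , par-identityˡ)

Replicative : Proc Act → Set
Replicative {Act} Φ = ∀ {a W} → Φ ─[ a ]→ W → Σ (Proc Act) λ X → W ≡ₛ par Φ X

bangAll-replicative : (xs : List (Act × FProc Act)) → Replicative (bangAll xs)
bangAll-replicative [] (p-fin ())
bangAll-replicative ((a , F) ∷ []) p-bang = fin F , refl
bangAll-replicative ((a , F) ∷ _ ∷ _) (p-parL p-bang) = fin F , par-swapʳ
bangAll-replicative ((a , F) ∷ y ∷ ys) (p-parR t) =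
  let (X , e) = bangAll-replicative (y ∷ ys) t in X , trans (par-cong refl e) (sym par-assoc)

module Absorption {Act : Set} {Φ : Proc Act} (replicative : Replicative Φ)
                  {R : Rel (Proc Act) 0ℓ} (isBisimulation : IsBisimulation R) where

  infix 4 _≈_

  data _≈_ : Rel (Proc Act) 0ℓ where
    base     : R P Q → P ≈ Q
    struct   : P ≡ₛ Q → P ≈ Q
    sym      : P ≈ Q → Q ≈ P
    trans    : P ≈ Q → Q ≈ S → P ≈ S
    par-cong : P₁ ≈ Q₁ → P₂ ≈ Q₂ → par P₁ P₂ ≈ par Q₁ Q₂
    dup      : Φ ≈ par Φ Φ
    absorb   : ∀ Z → Φ ≈ par A C → par (par Z Φ) A ≈ par Z Φ

  ≈-setoid : Setoid 0ℓ 0ℓ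
  ≈-setoid = record
    { Carrier       = Proc Act
    ; _≈_           = _≈_
    ; isEquivalence = record { refl = struct refl ; sym = sym ; trans = trans }
    }

  open SetoidReasoning ≈-setoid

  derivative-≈-par-Φ : Φ ─[ a ]→ W → W ≈ par W Φ
  derivative-≈-par-Φ {W = W} t with replicative t
  ... | X , e = begin
    W                ≈⟨ struct e ⟩
    par Φ X          ≈⟨ par-cong dup (struct refl) ⟩
    par (par Φ Φ) X  ≈⟨ struct par-swapʳ ⟩
    par (par Φ X) Φ  ≈⟨ par-cong (struct e) (struct refl) ⟨
    par W Φ          ∎

  dup-progress : Progress _≈_ Φ (par Φ Φ)
  dup-progress =
      (λ t → _ , p-parL t , derivative-≈-par-Φ t)
    , (λ { (p-parL t) → _ , t , derivative-≈-par-Φ t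
         ; (p-parR t) → _ , t , trans (derivative-≈-par-Φ t) (struct par-comm) })

  absorb-derivative : Φ ─[ a ]→ W → Φ ≈ par A C → par (par Z W) A ≈ par Z W
  absorb-derivative {W = W} {A = A} {Z = Z} t h with replicative t
  ... | X , e = begin
    par (par Z W) A          ≈⟨ par-cong ZW≈ZXΦ (struct refl) ⟩
    par (par (par Z X) Φ) A  ≈⟨ absorb (par Z X) h ⟩
    par (par Z X) Φ          ≈⟨ ZW≈ZXΦ ⟨
    par Z W                  ∎
    where
    ZW≈ZXΦ : par Z W ≈ par (par Z X) Φ
    ZW≈ZXΦ = struct (trans (par-cong refl (trans e par-comm)) (sym par-assoc))

  absorb-progress : Φ ≈ par A C → Progress _≈_ Φ (par A C) →
                    Progress _≈_ (par (par Z Φ) A) (par Z Φ)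
  absorb-progress {A = A} {C = C} {Z = Z} h (_ , h-bwd) =
      (λ { (p-parL (p-parL t)) → _ , p-parL t , absorb _ h
         ; (p-parL (p-parR t)) → _ , p-parR t , absorb-derivative t h
         ; (p-parR t)          → move-of-A t })
    , (λ { (p-parL t) → _ , p-parL (p-parL t) , absorb _ h
         ; (p-parR t) → _ , p-parL (p-parR t) , absorb-derivative t h })
    where
    move-of-A : ∀ {A'} → A ─[ a ]→ A' →
                Σ (Proc Act) λ Q' → (par Z Φ ─[ a ]→ Q') × par (par Z Φ) A' ≈ Q'
    move-of-A {A' = A'} t with h-bwd (p-parL t)
    ... | W , Φ→W , W≈A'C with proj₂ dup-progress (p-parR Φ→W)
    ... | W′ , Φ→W′ , W′≈ΦW = _ , p-parR Φ→W′ , (begin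
      par (par Z Φ) A'              ≈⟨ struct par-swapʳ ⟩
      par (par Z A') Φ              ≈⟨ absorb (par Z A') (trans h (struct par-comm)) ⟨
      par (par (par Z A') Φ) C      ≈⟨ struct (trans par-assoc (trans par-assoc
                                         (par-cong refl par-swapˡ))) ⟩
      par Z (par Φ (par A' C))      ≈⟨ par-cong (struct refl) (par-cong (struct refl) W≈A'C) ⟨
      par Z (par Φ W)               ≈⟨ par-cong (struct refl) W′≈ΦW ⟨
      par Z W′                      ∎)

  ≈-isBisimulation : IsBisimulation _≈_
  ≈-isBisimulation (base r)       = progress-map base (isBisimulation r)
  ≈-isBisimulation (struct e)     = progress-map struct (≡ₛ-isBisimulation e)
  ≈-isBisimulation (sym p)        = progress-map sym (progress-flip (≈-isBisimulation p))
  ≈-isBisimulation (trans p q)    =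
    progress-trans trans (≈-isBisimulation p) (≈-isBisimulation q)
  ≈-isBisimulation (par-cong p q) =
    progress-par par-cong p q (≈-isBisimulation p) (≈-isBisimulation q)
  ≈-isBisimulation dup            = dup-progress
  ≈-isBisimulation (absorb _ h)   = absorb-progress h (≈-isBisimulation h)

replicative-absorbs : {Φ A C : Proc Act} → Replicative Φ → Φ ∼ par A C → Φ ∼ par Φ A
replicative-absorbs {Φ = Φ} {A = A} replicative (R , isBisimulation , r) =
  _≈_ , ≈-isBisimulation , Φ≈ΦA
  where
  open Absorption replicative isBisimulation
  open SetoidReasoning ≈-setoid
  Φ≈ΦA : Φ ≈ par Φ A
  Φ≈ΦA = begin
    Φ                        ≈⟨ struct par-identityˡ ⟨
    par (fin nil) Φ          ≈⟨ absorb (fin nil) (base r) ⟨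
    par (par (fin nil) Φ) A  ≈⟨ struct (par-cong par-identityˡ refl) ⟩
    par Φ A                  ∎

lemma1 : (Act : Set) (enc : Act → ℕ) → Injective _≡_ _≡_ enc →
         (Fs : List (Act × FProc Act)) (F' : FProc Act) (α : Act) (Q : Proc Act) →
         bangAll Fs ∼ par (fin (pre α F')) Q →
         bangAll Fs ∼ par (bangAll Fs) (fin (pre α F'))
lemma1 _ _ _ Fs _ _ _ = replicative-absorbs (bangAll-replicative Fs)
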